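{- Let $\mathbf{u}=vw^{\infty}$ with $v,w\in\{0,1\}^*$, $w\neq\varepsilon$, be an eventually periodic infinite word whose set of factors contains infinitely many antipalindromes. Then $w=w_1w_2$ where $w_1,w_2$ are antipalindromes.
   Context: $\varepsilon$ is the empty word; $w^\infty$ denotes the infinite repetition of $w$. $\mathrm{E}(w_1\cdots w_n)=(1-w_n)\cdots(1-w_1)$ on binary words; a word $x$ is an antipalindrome if $\mathrm{E}(x)=x$ (the empty word counts as an antipalindrome). -}

module Defs where

open import Data.Bool using (Bool; not; false)
open import Data.Nat using (ℕ; zero; suc; _+_)
open import Data.Nat.DivMod using (_mod_)
open import Data.List using (List; []; _∷_; _++_; length; map; reverse; lookup; upTo)
open import Data.Product using (∃)
open import Relation.Binary.PropositionalEquality using (_≡_)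

-- binary words are lists of booleans (false = 0, true = 1);
-- infinite words are functions ℕ → Bool

E : List Bool → List Bool
E x = reverse (map not x)

Antipalindrome : List Bool → Set
Antipalindrome x = E x ≡ x

_·_ : List Bool → (ℕ → Bool) → ℕ → Bool
([] · f) i = f i
((b ∷ v) · f) zero = b
((b ∷ v) · f) (suc i) = (v · f) i

-- w^∞ (the empty case is irrelevant: the theorem assumes w ≠ ε)
_^∞ : List Bool → ℕ → Bool
([] ^∞) i = false
((b ∷ w) ^∞) i = lookup (b ∷ w) (i mod suc (length w))

slice : (ℕ → Bool) → ℕ → ℕ → List Bool
slice u i n = map (λ j → u (i + j)) (upTo n)

Factor : (ℕ → Bool) → List Bool → Set
Factor u x = ∃ λ i → slice u i (length x) ≡ x

module Submission where

-- Call a letter function g "anti-mirrored about n" when g a and g b are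
-- complementary whenever a + b + 1 = n; a finite word g 0 ⋯ g (n-1) is an antipalindrome
-- exactly when g is anti-mirrored about n (antipalindrome⇒mirror, mirror⇒antipalindrome).
--
-- Since only finitely many words are shorter than |v| + |w| + |v|, some antipalindromic
-- factor x of v·w^∞ is that long.  Cutting |v| letters off each end of x leaves an
-- antipalindrome lying inside w^∞, of length r ≥ |w|, starting at some position i.
-- For the |w|-periodic word f = w^∞ such a window can be widened one letter on each side
-- (moving the border letters by one period), down to position 0: f is anti-mirrored about
-- i + i + r.  Periodicity also lets us subtract |w| from the mirror, so f is anti-mirrored
-- about some t < |w| and about t + |w|.  Finally w = f 0 ⋯ f (|w|-1) splits at t: the prefix
-- of length t is an antipalindrome by the mirror at t, the rest by the mirror at t + |w|.

open import Defs
open import Data.Bool using (Bool; true; false; not)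
open import Data.Bool.Properties using (not-involutive)
open import Data.Empty using (⊥-elim)
open import Data.Fin using (fromℕ<)
open import Data.Fin.Properties using (fromℕ<-cong)
open import Data.List using (List; []; _∷_; _++_; length; map; reverse; lookup; applyUpTo; applyDownFrom)
open import Data.List.Properties using (map-applyUpTo; reverse-applyUpTo; map-upTo; ∷-injective)
open import Data.List.Membership.Propositional using (_∈_; _∉_)
open import Data.List.Membership.Propositional.Properties using (∈-map⁺; ∈-++⁺ˡ; ∈-++⁺ʳ)
open import Data.List.Relation.Unary.Any using (here; there)
open import Data.Nat using (ℕ; zero; suc; _+_; _*_; _∸_; _≤_; _<_; z≤n; s≤s)
open import Data.Nat.Properties
open import Data.Nat.DivMod using (_%_; _/_; m%n<n; m≡m%n+[m/n]*n; [m+n]%n≡m%n; m<n⇒m%n≡m)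
open import Data.Nat.Tactic.RingSolver using (solve-∀)
open import Data.Product using (∃; ∃₂; _×_; _,_; proj₁; proj₂)
open import Function using (_∘_)
open import Relation.Binary.PropositionalEquality using (_≡_; _≢_; refl; sym; trans; cong; cong₂; subst; module ≡-Reasoning)
open ≡-Reasoning

private
  variable
    A : Set

complement-sym : ∀ {x y} → x ≡ not y → y ≡ not x
complement-sym {y = y} x≡¬y = trans (sym (not-involutive y)) (cong not (sym x≡¬y))

applyUpTo-++ : ∀ (h : ℕ → A) m n →
               applyUpTo h (m + n) ≡ applyUpTo h m ++ applyUpTo (λ j → h (m + j)) n
applyUpTo-++ h zero    n = refl
applyUpTo-++ h (suc m) n = cong (h 0 ∷_) (applyUpTo-++ (h ∘ suc) m n)

applyUpTo-cong : ∀ {g h : ℕ → A} n → (∀ j → j < n → g j ≡ h j) → applyUpTo g n ≡ applyUpTo h n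
applyUpTo-cong zero    g≡h = refl
applyUpTo-cong (suc n) g≡h =
  cong₂ _∷_ (g≡h 0 (s≤s z≤n)) (applyUpTo-cong n (λ j j<n → g≡h (suc j) (s≤s j<n)))

applyUpTo-injective : ∀ {g h : ℕ → A} n → applyUpTo g n ≡ applyUpTo h n → ∀ j → j < n → g j ≡ h j
applyUpTo-injective (suc n) eq zero    _         = proj₁ (∷-injective eq)
applyUpTo-injective (suc n) eq (suc j) (s≤s j<n) = applyUpTo-injective n (proj₂ (∷-injective eq)) j j<n

applyUpTo-lookup : ∀ (x : List A) (g : ℕ → A) →
                   (∀ j (j<|x| : j < length x) → g j ≡ lookup x (fromℕ< j<|x|)) →
                   applyUpTo g (length x) ≡ x
applyUpTo-lookup []      g g≡x = refl
applyUpTo-lookup (c ∷ x) g g≡x =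
  cong₂ _∷_ (g≡x 0 (s≤s z≤n)) (applyUpTo-lookup x (g ∘ suc) (λ j j< → g≡x (suc j) (s≤s j<)))

applyDownFrom-as-applyUpTo : ∀ (g : ℕ → A) n → applyDownFrom g n ≡ applyUpTo (λ j → g (n ∸ suc j)) n
applyDownFrom-as-applyUpTo g zero    = refl
applyDownFrom-as-applyUpTo g (suc n) = cong (g n ∷_) (applyDownFrom-as-applyUpTo g n)

E-applyUpTo : ∀ (h : ℕ → Bool) n → E (applyUpTo h n) ≡ applyUpTo (λ j → not (h (n ∸ suc j))) n
E-applyUpTo h n = begin
  reverse (map not (applyUpTo h n)) ≡⟨ cong reverse (map-applyUpTo h not n) ⟩
  reverse (applyUpTo (not ∘ h) n)   ≡⟨ reverse-applyUpTo (not ∘ h) n ⟩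
  applyDownFrom (not ∘ h) n         ≡⟨ applyDownFrom-as-applyUpTo (not ∘ h) n ⟩
  applyUpTo (λ j → not (h (n ∸ suc j))) n ∎

AntiMirror : (ℕ → Bool) → ℕ → Set
AntiMirror g n = ∀ a b → suc (a + b) ≡ n → g a ≡ not (g b)

antipalindrome⇒mirror : ∀ h n → Antipalindrome (applyUpTo h n) → AntiMirror h n
antipalindrome⇒mirror h n anti a b a+b+1≡n = begin
  h a                   ≡⟨ sym (applyUpTo-injective n (trans (sym (E-applyUpTo h n)) anti) a a<n) ⟩
  not (h (n ∸ suc a))   ≡⟨ cong (not ∘ h) n-a-1≡b ⟩
  not (h b)             ∎
  where
  a<n : a < n
  a<n = subst (a <_) a+b+1≡n (s≤s (m≤m+n a b))
  n-a-1≡b : n ∸ suc a ≡ b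
  n-a-1≡b = trans (cong (_∸ suc a) (sym a+b+1≡n)) (m+n∸m≡n (suc a) b)

mirror⇒antipalindrome : ∀ h n → AntiMirror h n → Antipalindrome (applyUpTo h n)
mirror⇒antipalindrome h n mirror = trans (E-applyUpTo h n) (applyUpTo-cong n reflect)
  where
  reflect : ∀ j → j < n → not (h (n ∸ suc j)) ≡ h j
  reflect j j<n = sym (mirror j (n ∸ suc j) (m+[n∸m]≡n j<n))

mirror-cong : ∀ {g h} n → (∀ j → g j ≡ h j) → AntiMirror g n → AntiMirror h n
mirror-cong {g} {h} n g≡h mirror a b e = begin
  h a       ≡⟨ sym (g≡h a) ⟩
  g a       ≡⟨ mirror a b e ⟩
  not (g b) ≡⟨ cong not (g≡h b) ⟩
  not (h b) ∎

mirror-centre : ∀ g k n → AntiMirror g (k + n + k) → AntiMirror (λ j → g (k + j)) n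
mirror-centre g k n mirror a b a+b+1≡n =
  mirror (k + a) (k + b) (trans (shift k a b) (cong (λ m → k + m + k) a+b+1≡n))
  where
  shift : ∀ k a b → suc ((k + a) + (k + b)) ≡ k + suc (a + b) + k
  shift = solve-∀

module Periodic (f : ℕ → Bool) (p : ℕ) (periodic : ∀ n → f (n + suc p) ≡ f n) where

  -- A window [m+1, m+1+S) anti-mirrored and at least one period long extends to
  -- [m, m+S+2): each new border letter equals, one period inwards, a letter of the window.
  extend : ∀ m S → suc p ≤ S → AntiMirror (λ j → f (suc m + j)) S →
           AntiMirror (λ j → f (m + j)) (suc (suc S))
  extend m S P≤S mirror = mirror′
    where
    d : ℕ
    d = proj₁ (m≤n⇒∃[o]m+o≡n P≤S)
    P+d≡S : suc p + d ≡ S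
    P+d≡S = proj₂ (m≤n⇒∃[o]m+o≡n P≤S)

    left≡ : ∀ m p → suc m + p ≡ m + 0 + suc p
    left≡ = solve-∀
    right≡ : ∀ m p d → m + suc (suc p + d) ≡ suc m + d + suc p
    right≡ = solve-∀

    border : ∀ b → suc b ≡ suc (suc S) → f (m + 0) ≡ not (f (m + b))
    border b e = begin
      f (m + 0)         ≡⟨ sym (trans (cong f (left≡ m p)) (periodic (m + 0))) ⟩
      f (suc m + p)     ≡⟨ mirror p d P+d≡S ⟩
      not (f (suc m + d)) ≡⟨ cong not (sym (trans (cong f (right≡ m p d)) (periodic (suc m + d)))) ⟩
      not (f (m + suc (suc p + d))) ≡⟨ cong (λ c → not (f (m + suc c))) P+d≡S ⟩
      not (f (m + suc S)) ≡⟨ cong (λ c → not (f (m + c))) (sym (suc-injective e)) ⟩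
      not (f (m + b))   ∎

    mirror′ : AntiMirror (λ j → f (m + j)) (suc (suc S))
    mirror′ zero    b       e = border b e
    mirror′ (suc a) zero    e = complement-sym (border (suc a) (trans (cong suc (sym (+-identityʳ (suc a)))) e))
    mirror′ (suc a) (suc b) e = begin
      f (m + suc a)       ≡⟨ cong f (+-suc m a) ⟩
      f (suc m + a)       ≡⟨ mirror a b (trans (sym (+-suc a b)) (suc-injective (suc-injective e))) ⟩
      not (f (suc m + b)) ≡⟨ cong (not ∘ f) (sym (+-suc m b)) ⟩
      not (f (m + suc b)) ∎

  widen : ∀ m S → suc p ≤ S → AntiMirror (λ j → f (m + j)) S → AntiMirror f (m + m + S)
  widen zero    S P≤S mirror = mirror
  widen (suc m) S P≤S mirror =
    subst (AntiMirror f) (centre≡ m S)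
      (widen m (suc (suc S)) (≤-trans P≤S (m≤n+m S 2)) (extend m S P≤S mirror))
    where
    centre≡ : ∀ m S → m + m + suc (suc S) ≡ suc m + suc m + S
    centre≡ = solve-∀

  shrink : ∀ T → AntiMirror f (T + suc p) → AntiMirror f T
  shrink T mirror a b a+b+1≡T = begin
    f a               ≡⟨ sym (periodic a) ⟩
    f (a + suc p)     ≡⟨ mirror (a + suc p) b (trans (moved a (suc p) b) (cong (_+ suc p) a+b+1≡T)) ⟩
    not (f b)         ∎
    where
    moved : ∀ a P b → suc (a + P + b) ≡ suc (a + b) + P
    moved = solve-∀

  shrink* : ∀ k T → AntiMirror f (T + k * suc p) → AntiMirror f T
  shrink* zero    T mirror = subst (AntiMirror f) (+-identityʳ T) mirror
  shrink* (suc k) T mirror =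
    shrink T (shrink* k (T + suc p) (subst (AntiMirror f) (sym (+-assoc T (suc p) (k * suc p))) mirror))

  residue : ∀ S → suc p ≤ S → AntiMirror f S →
            ∃ λ t → t < suc p × AntiMirror f t × AntiMirror f (t + suc p)
  residue S P≤S mirror with S / suc p | m≡m%n+[m/n]*n S (suc p)
  ... | zero  | S≡t+0 =
    ⊥-elim (<⇒≱ (subst (_< suc p) (sym (trans S≡t+0 (+-identityʳ (S % suc p)))) (m%n<n S (suc p))) P≤S)
  ... | suc q | S≡t+P+qP = S % suc p , m%n<n S (suc p) , shrink (S % suc p) mirror-t+P , mirror-t+P
    where
    mirror-t+P : AntiMirror f (S % suc p + suc p)
    mirror-t+P = shrink* q (S % suc p + suc p)
      (subst (AntiMirror f) (trans S≡t+P+qP (sym (+-assoc (S % suc p) (suc p) (q * suc p)))) mirror)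

split-at-mirrors : ∀ (h : ℕ → Bool) t n → AntiMirror h t → AntiMirror h (t + (t + n)) →
                   ∃₂ λ w₁ w₂ → applyUpTo h (t + n) ≡ w₁ ++ w₂ × Antipalindrome w₁ × Antipalindrome w₂
split-at-mirrors h t n mirror-t mirror-far =
  applyUpTo h t , applyUpTo (λ j → h (t + j)) n , applyUpTo-++ h t n ,
  mirror⇒antipalindrome h t mirror-t ,
  mirror⇒antipalindrome (λ j → h (t + j)) n
    (mirror-centre h t n (subst (AntiMirror h) (rearrange t n) mirror-far))
  where
  rearrange : ∀ t n → t + (t + n) ≡ t + n + t
  rearrange = solve-∀

prefix-shift : ∀ v (f : ℕ → Bool) n → (v · f) (length v + n) ≡ f n
prefix-shift []      f n = refl
prefix-shift (b ∷ v) f n = prefix-shift v f n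

^∞-periodic : ∀ b w′ n → ((b ∷ w′) ^∞) (n + suc (length w′)) ≡ ((b ∷ w′) ^∞) n
^∞-periodic b w′ n =
  cong (lookup (b ∷ w′)) (fromℕ<-cong _ _ ([m+n]%n≡m%n n (suc (length w′))) _ _)

^∞-period : ∀ b w′ → applyUpTo ((b ∷ w′) ^∞) (suc (length w′)) ≡ b ∷ w′
^∞-period b w′ = applyUpTo-lookup (b ∷ w′) ((b ∷ w′) ^∞)
  (λ j j<P → cong (lookup (b ∷ w′)) (fromℕ<-cong _ _ (m<n⇒m%n≡m j<P) _ _))

factor-window : ∀ v f x i r → slice (v · f) i (length x) ≡ x → Antipalindrome x →
                length x ≡ length v + r + length v → AntiMirror (λ j → f (i + j)) r
factor-window v f x i r x-at-i anti |x|≡ =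
  mirror-cong r (λ j → trans (cong (v · f) (reorder i (length v) j)) (prefix-shift v f (i + j)))
    (mirror-centre (λ j → (v · f) (i + j)) (length v) r
      (subst (AntiMirror (λ j → (v · f) (i + j))) |x|≡
        (antipalindrome⇒mirror (λ j → (v · f) (i + j)) (length x)
          (subst Antipalindrome (trans (sym x-at-i) (map-upTo (λ j → (v · f) (i + j)) (length x))) anti))))
  where
  reorder : ∀ i V j → i + (V + j) ≡ V + (i + j)
  reorder = solve-∀

-- All words of length < n, so that some antipalindromic factor avoids them.
shorterThan : ℕ → List (List Bool)
shorterThan zero    = []
shorterThan (suc n) = [] ∷ map (true ∷_) (shorterThan n) ++ map (false ∷_) (shorterThan n)

shorterThan-complete : ∀ n x → length x < n → x ∈ shorterThan n
shorterThan-complete (suc n) []          _         = here refl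
shorterThan-complete (suc n) (true ∷ x)  (s≤s |x|<n) =
  there (∈-++⁺ˡ (∈-map⁺ (true ∷_) (shorterThan-complete n x |x|<n)))
shorterThan-complete (suc n) (false ∷ x) (s≤s |x|<n) =
  there (∈-++⁺ʳ (map (true ∷_) (shorterThan n)) (∈-map⁺ (false ∷_) (shorterThan-complete n x |x|<n)))

long-middle : ∀ V P ℓ → V + P + V ≤ ℓ → ∃ λ r → P ≤ r × ℓ ≡ V + r + V
long-middle V P ℓ N≤ℓ with m≤n⇒∃[o]m+o≡n N≤ℓ
... | g , N+g≡ℓ = P + g , m≤m+n P g , trans (sym N+g≡ℓ) (regroup V P g)
  where
  regroup : ∀ V P g → V + P + V + g ≡ V + (P + g) + V
  regroup = solve-∀

lemma25 : (v w : List Bool) → w ≢ [] →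
          ((xs : List (List Bool)) → ∃ λ x → Factor (v · (w ^∞)) x × Antipalindrome x × x ∉ xs) →
          ∃₂ λ w₁ w₂ → w ≡ w₁ ++ w₂ × Antipalindrome w₁ × Antipalindrome w₂
lemma25 v []       w≢[] _ = ⊥-elim (w≢[] refl)
lemma25 v (b ∷ w′) _ infinitelyMany =
  let (x , (i , x-at-i) , x-anti , x-new) = infinitelyMany (shorterThan (V + P + V))
      long = ≮⇒≥ (λ short → x-new (shorterThan-complete (V + P + V) x short))
      (r , P≤r , |x|≡) = long-middle V P (length x) long
      window = factor-window v f x i r x-at-i x-anti |x|≡
      (t , t<P , mirror-t , mirror-t+P) =
        residue (i + i + r) (≤-trans P≤r (m≤n+m r (i + i))) (widen i r P≤r window)
      (n , t+n≡P) = m≤n⇒∃[o]m+o≡n (<⇒≤ t<P)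
      (w₁ , w₂ , split , anti₁ , anti₂) =
        split-at-mirrors f t n mirror-t (subst (λ c → AntiMirror f (t + c)) (sym t+n≡P) mirror-t+P)
      w≡w₁w₂ = trans (sym (^∞-period b w′)) (trans (cong (applyUpTo f) (sym t+n≡P)) split)
  in w₁ , w₂ , w≡w₁w₂ , anti₁ , anti₂
  where
  V = length v
  P = suc (length w′)
  f = (b ∷ w′) ^∞
  open Periodic f (length w′) (^∞-periodic b w′)
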